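{- If $G$ is a Helly graph with no induced wheel $W_k$ for any $k\ge 4$, then $G$ is chordal.
   Context: Graphs are finite, connected, simple, with shortest-path metric. A graph is Helly if every family of pairwise intersecting disks $D(v,r)=\{u:d(u,v)\le r\}$ has a common vertex. The wheel $W_k$ is an induced cycle on $k$ vertices together with one additional vertex adjacent to all of them. A graph is chordal if it has no induced cycle of length at least 4. -}

module Defs where

open import Data.Nat using (ℕ; zero; suc; _≤_)
open import Data.Fin using (Fin; toℕ)
open import Data.Bool using (Bool; true; false)
open import Data.Product using (Σ; _×_; _,_; ∃)
open import Data.Sum using (_⊎_)
open import Relation.Binary.PropositionalEquality using (_≡_; _≢_)
open import Relation.Nullary using (¬_)
open import Function.Definitions using (Injective)
open import Function.Bundles using (_⇔_)

record Graph (n : ℕ) : Set where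
  field
    adj       : Fin n → Fin n → Bool
    adj-sym   : ∀ u v → adj u v ≡ adj v u
    adj-irref : ∀ u → adj u u ≡ false

open Graph public

module _ {n : ℕ} (G : Graph n) where

  Edge : Fin n → Fin n → Set
  Edge u v = adj G u v ≡ true

  data Walk : Fin n → Fin n → ℕ → Set where
    nil  : ∀ {u} → Walk u u 0
    cons : ∀ {u w v k} → Edge u w → Walk w v k → Walk u v (suc k)

  DistLe : Fin n → Fin n → ℕ → Set
  DistLe u v r = Σ ℕ λ k → k ≤ r × Walk u v k

  Connected : Set
  Connected = ∀ u v → Σ ℕ λ k → Walk u v k

  InDisk : Fin n → ℕ → Fin n → Set
  InDisk c r u = DistLe u c r

  -- Helly: every (finite, which is no restriction in a finite graph) family of
  -- pairwise intersecting disks has a common vertex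
  Helly : Set
  Helly = ∀ (m : ℕ) (c : Fin m → Fin n) (r : Fin m → ℕ) →
          (∀ i j → Σ (Fin n) λ u → InDisk (c i) (r i) u × InDisk (c j) (r j) u) →
          Σ (Fin n) λ u → ∀ i → InDisk (c i) (r i) u

CycAdj : (k : ℕ) → Fin k → Fin k → Set
CycAdj k i j =
  (suc (toℕ i) ≡ toℕ j) ⊎ (suc (toℕ j) ≡ toℕ i) ⊎
  ((suc (toℕ i) ≡ k × toℕ j ≡ 0) ⊎ (suc (toℕ j) ≡ k × toℕ i ≡ 0))

module _ {n : ℕ} (G : Graph n) where

  InducedCycle : (k : ℕ) → (Fin k → Fin n) → Set
  InducedCycle k c = Injective _≡_ _≡_ c × (∀ i j → Edge G (c i) (c j) ⇔ CycAdj k i j)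

  HasInducedCycle : ℕ → Set
  HasInducedCycle k = Σ (Fin k → Fin n) λ c → InducedCycle k c

  HasInducedWheel : ℕ → Set
  HasInducedWheel k = Σ (Fin n) λ h → Σ (Fin k → Fin n) λ c →
    InducedCycle k c × (∀ i → h ≢ c i) × (∀ i → Edge G h (c i))

  Chordal : Set
  Chordal = ∀ k → 4 ≤ k → ¬ HasInducedCycle k

module Submission where

-- Fix a base vertex w and write d(x) for the distance from x to w.  To an induced
-- cycle g 0, …, g k' we attach the potential Σ_j d(g j), and show that every induced
-- cycle of length ≥ 4 yields another one of strictly smaller potential; by
-- well-founded induction there is then no such cycle at all.
--
-- Rotate the cycle so that g 0 is a vertex farthest from w, say
-- d(g 0) = r + 1.  The unit disks around g k', g 0, g 1 and the r-disk around w
-- pairwise meet, so by the Helly property some vertex v lies in all four.  Since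
-- d(v) ≤ r, v is not on the cycle, hence it is adjacent to g k', g 0 and g 1.  If v
-- were adjacent to every g j it would be the hub of an induced wheel; otherwise
-- there is a gap: indices b < b + len in 1..k' with v adjacent to g b and
-- g (b + len) but to nothing strictly between.  Then v, g b, …, g (b + len) is an
-- induced cycle of length ≥ 4, and it has smaller potential because v replaced the
-- farther vertex g 0 and the rest is part of g 1, …, g k'.

open import Defs
open import Data.Nat using (ℕ; zero; suc; pred; _+_; _≤_; _<_; _≟_; _≤?_; z≤n; s≤s; ≢-nonZero)
open import Data.Nat.Properties
open import Data.Nat.DivMod using (_mod_; m<n⇒m%n≡m)
open import Data.Nat.Induction using (<-rec)
open import Data.Fin using (Fin; toℕ)
import Data.Fin as Fin
open import Data.Fin.Patterns using (0F; 1F; 2F; 3F)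
open import Data.Fin.Properties using (toℕ-injective; toℕ<n; toℕ-fromℕ<; any?)
open import Data.Bool using (true)
import Data.Bool as Bool
open import Data.Product using (Σ; _×_; _,_; proj₁; proj₂)
open import Data.Sum using (_⊎_; inj₁; inj₂; [_,_]′; swap)
import Data.Sum as Sum
open import Data.Empty using (⊥; ⊥-elim)
open import Function using (_∘_; id)
open import Function.Bundles using (_⇔_; mk⇔; Equivalence)
import Function.Properties.Equivalence as ⇔
open import Relation.Nullary using (¬_; Dec; yes; no; contradiction)
open import Relation.Nullary.Decidable using (_×-dec_; ¬?; decidable-stable)
open import Relation.Binary.PropositionalEquality

sumTo : (ℕ → ℕ) → ℕ → ℕ
sumTo F zero    = 0
sumTo F (suc m) = F 0 + sumTo (λ t → F (suc t)) m

sumTo-snoc : ∀ F m → sumTo F (suc m) ≡ sumTo F m + F m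
sumTo-snoc F zero    = +-identityʳ (F 0)
sumTo-snoc F (suc m) = trans (cong (F 0 +_) (sumTo-snoc (λ t → F (suc t)) m))
                             (sym (+-assoc (F 0) _ _))

sumTo-cong : ∀ F H m → (∀ j → j < m → F j ≡ H j) → sumTo F m ≡ sumTo H m
sumTo-cong F H zero    _  = refl
sumTo-cong F H (suc m) eq = cong₂ _+_ (eq 0 (s≤s z≤n))
  (sumTo-cong (λ t → F (suc t)) (λ t → H (suc t)) m (λ j j<m → eq (suc j) (s≤s j<m)))

sumTo-window : ∀ F a len M → a + len ≤ M → sumTo (λ t → F (a + t)) len ≤ sumTo F M
sumTo-window F zero    zero      M       _         = z≤n
sumTo-window F zero    (suc len) (suc M) (s≤s le)  =
  +-monoʳ-≤ (F 0) (sumTo-window (λ t → F (suc t)) zero len M le)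
sumTo-window F (suc a) len       (suc M) (s≤s le)  =
  ≤-trans (sumTo-window (λ t → F (suc t)) a len M le) (m≤n+m _ (F 0))

firstHit : {Q : ℕ → Set} → (∀ t → Dec (Q t)) → ∀ m →
           (∀ t → t < m → ¬ Q t) ⊎ Σ ℕ λ t → t < m × Q t × (∀ j → j < t → ¬ Q j)
firstHit Q? zero = inj₁ λ _ ()
firstHit Q? (suc m) with Q? 0
... | yes q₀ = inj₂ (0 , s≤s z≤n , q₀ , λ _ ())
... | no ¬q₀ with firstHit (λ t → Q? (suc t)) m
...   | inj₁ none = inj₁ λ { zero _ → ¬q₀ ; (suc t) (s≤s t<m) → none t t<m }
...   | inj₂ (t , t<m , qₜ , before) =
  inj₂ (suc t , s≤s t<m , qₜ , λ { zero _ → ¬q₀ ; (suc j) (s≤s j<t) → before j j<t })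

leastWitness : {Q : ℕ → Set} → (∀ t → Dec (Q t)) → ∀ K → Q K →
               Σ ℕ λ t → Q t × (∀ j → j < t → ¬ Q j)
leastWitness Q? K q with firstHit Q? (suc K)
... | inj₁ none                 = ⊥-elim (none K ≤-refl q)
... | inj₂ (t , _ , qₜ , before) = t , qₜ , before

argmax : (F : ℕ → ℕ) (m : ℕ) → Σ ℕ λ i → i < suc m × (∀ j → j < suc m → F j ≤ F i)
argmax F zero = 0 , s≤s z≤n , λ { zero _ → ≤-refl ; (suc j) (s≤s ()) }
argmax F (suc m) with argmax F m
... | i , i<  , max with F (suc m) ≤? F i
...   | yes new≤ = i , m<n⇒m<1+n i< ,
  λ j j< → [ max j , (λ { refl → new≤ }) ]′ (m<1+n⇒m<n∨m≡n j<)
...   | no new≰ = suc m , ≤-refl ,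
  λ j j< → [ (λ j<′ → ≤-trans (max j j<′) (<⇒≤ (≰⇒> new≰))) , (λ { refl → ≤-refl }) ]′
             (m<1+n⇒m<n∨m≡n j<)

record Gap (P : ℕ → Set) (m : ℕ) : Set where
  field
    start len : ℕ
    start≥1   : 1 ≤ start
    len≥2     : 2 ≤ len
    end≤m     : start + len ≤ m
    atStart   : P start
    atEnd     : P (start + len)
    between   : ∀ t → 0 < t → t < len → ¬ P (start + t)

gapAfter : {P : ℕ → Set} → (∀ j → Dec (P j)) → ∀ s m → 1 ≤ s → P s → ¬ P (suc s) →
           suc s ≤ m → P m → Gap P m
gapAfter {P} P? s m s≥1 pₛ ¬pₛ₊₁ s<m pₘ with m≤n⇒∃[o]m+o≡n (<⇒≤ s<m)
... | o , refl with firstHit (λ t → (1 ≤? t) ×-dec P? (s + t)) (suc o)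
...   | inj₁ none = ⊥-elim (none o ≤-refl (o≥1 , pₘ))
  where
  o≥1 : 1 ≤ o
  o≥1 = +-cancelˡ-≤ s 1 o (subst (_≤ s + o) (+-comm 1 s) s<m)
...   | inj₂ (len , len<o+1 , (len≥1 , pₑ) , before) = record
  { start   = s
  ; len     = len
  ; start≥1 = s≥1
  ; len≥2   = ≤∧≢⇒< len≥1 (λ 1≡len → ¬pₛ₊₁ (subst P (+-comm s 1) (subst (λ x → P (s + x)) (sym 1≡len) pₑ)))
  ; end≤m   = +-monoʳ-≤ s (≤-pred len<o+1)
  ; atStart = pₛ
  ; atEnd   = pₑ
  ; between = λ t t>0 t<len pₜ → before t t<len (t>0 , pₜ)
  }

allOrGap : {P : ℕ → Set} → (∀ j → Dec (P j)) → ∀ m → P 1 → P m →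
           (∀ j → 1 ≤ j → j ≤ m → P j) ⊎ Gap P m
allOrGap P? m p₁ pₘ with firstHit (λ t → ¬? (P? (suc t))) m
... | inj₁ none = inj₁ λ { (suc t) _ t<m → decidable-stable (P? (suc t)) (none t t<m) }
... | inj₂ (zero , _ , ¬p₁ , _) = ⊥-elim (¬p₁ p₁)
... | inj₂ (suc a , a+1<m , ¬pₐ₊₂ , before) =
  inj₂ (gapAfter P? (suc a) m (s≤s z≤n) (decidable-stable (P? (suc a)) (before a ≤-refl))
                 ¬pₐ₊₂ a+1<m pₘ)

next : ℕ → ℕ → ℕ
next k' j with j ≟ k'
... | yes _ = 0
... | no  _ = suc j

next-last : ∀ k' → next k' k' ≡ 0
next-last k' with k' ≟ k'
... | yes _   = refl
... | no k'≢k' = contradiction refl k'≢k'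

next-below : ∀ {k' j} → j < k' → next k' j ≡ suc j
next-below {k'} {j} j<k' with j ≟ k'
... | yes j≡k' = contradiction j≡k' (<⇒≢ j<k')
... | no  _    = refl

next-bounded : ∀ {k'} j → j < suc k' → next k' j < suc k'
next-bounded {k'} j j< with j ≟ k'
... | yes _   = s≤s z≤n
... | no j≢k' = s≤s (≤∧≢⇒< (≤-pred j<) j≢k')

next-inv : ∀ {k' i j} → next k' i ≡ j → suc i ≡ j ⊎ (i ≡ k' × j ≡ 0)
next-inv {k'} {i} e with i ≟ k'
... | yes i≡k' = inj₂ (i≡k' , sym e)
... | no  _    = inj₁ e

next-injective : ∀ {k'} i j → next k' i ≡ next k' j → i ≡ j
next-injective {k'} i j e with next-inv e | next-inv {k'} {j} refl
... | inj₁ si        | inj₁ sj        = suc-injective (trans si (sym sj))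
... | inj₁ si        | inj₂ (_ , z)   = contradiction (trans si z) 1+n≢0
... | inj₂ (_ , z)   | inj₁ sj        = contradiction (trans sj z) 1+n≢0
... | inj₂ (i≡k' , _) | inj₂ (j≡k' , _) = trans i≡k' (sym j≡k')

CycNbr : ℕ → ℕ → ℕ → Set
CycNbr k' i j = next k' i ≡ j ⊎ next k' j ≡ i

cycNbr-comm : ∀ {k' i j} → CycNbr k' i j ⇔ CycNbr k' j i
cycNbr-comm = mk⇔ swap swap

cycNbr-irrefl : ∀ {k' i} → 1 ≤ k' → ¬ CycNbr k' i i
cycNbr-irrefl k'≥1 (inj₁ e) with next-inv e
... | inj₁ si           = <-irrefl (sym si) ≤-refl
... | inj₂ (refl , refl) = contradiction k'≥1 λ ()
cycNbr-irrefl k'≥1 (inj₂ e) = cycNbr-irrefl k'≥1 (inj₁ e)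

consecutive⇒cycNbr : ∀ {k' i j} → i < suc k' → j < suc k' → suc i ≡ j ⊎ suc j ≡ i → CycNbr k' i j
consecutive⇒cycNbr _   (s≤s i<k') (inj₁ refl) = inj₁ (next-below i<k')
consecutive⇒cycNbr (s≤s j<k') _   (inj₂ refl) = inj₂ (next-below j<k')

cycNbr⇒consecutive : ∀ {k' i j} → 1 ≤ i → 1 ≤ j → CycNbr k' i j → suc i ≡ j ⊎ suc j ≡ i
cycNbr⇒consecutive i≥1 j≥1 (inj₁ e) with next-inv e
... | inj₁ si          = inj₁ si
... | inj₂ (_ , refl)  = contradiction j≥1 λ ()
cycNbr⇒consecutive i≥1 j≥1 (inj₂ e) with next-inv e
... | inj₁ sj          = inj₂ sj
... | inj₂ (_ , refl)  = contradiction i≥1 λ ()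

cycNbr-of-0 : ∀ {k t} → CycNbr (suc k) 0 (suc t) ⇔ (t ≡ 0 ⊎ t ≡ k)
cycNbr-of-0 {k} {t} = mk⇔ to from
  where
  to : CycNbr (suc k) 0 (suc t) → t ≡ 0 ⊎ t ≡ k
  to (inj₁ e) with next-inv {suc k} e
  ... | inj₁ 1≡t+1   = inj₁ (sym (suc-injective 1≡t+1))
  ... | inj₂ (() , _)
  to (inj₂ e) with next-inv {suc k} e
  ... | inj₁ ()
  ... | inj₂ (t+1≡k+1 , _) = inj₂ (suc-injective t+1≡k+1)
  from : t ≡ 0 ⊎ t ≡ k → CycNbr (suc k) 0 (suc t)
  from (inj₁ refl) = inj₁ (next-below {suc k} (s≤s z≤n))
  from (inj₂ refl) = inj₂ (next-last (suc k))

1<last : ∀ {k'} → 3 ≤ k' → 1 < k'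
1<last k'≥3 = ≤-trans (s≤s (s≤s z≤n)) k'≥3

1-far-from-last : ∀ {k'} → 3 ≤ k' → ¬ (1 ≡ k' ⊎ CycNbr k' 1 k')
1-far-from-last k'≥3 (inj₁ refl) = contradiction k'≥3 λ { (s≤s ()) }
1-far-from-last {k'} k'≥3 (inj₂ (inj₁ e)) = <⇒≢ k'≥3 (trans (sym (next-below (1<last k'≥3))) e)
1-far-from-last {k'} k'≥3 (inj₂ (inj₂ e)) = contradiction (trans (sym (next-last k')) e) λ ()

cycNbr⇔cycAdj : ∀ {k'} (i j : Fin (suc k')) → CycNbr k' (toℕ i) (toℕ j) ⇔ CycAdj (suc k') i j
cycNbr⇔cycAdj {k'} i j = mk⇔ to from
  where
  to : CycNbr k' (toℕ i) (toℕ j) → CycAdj (suc k') i j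
  to (inj₁ e) with next-inv e
  ... | inj₁ si           = inj₁ si
  ... | inj₂ (i≡k' , j≡0) = inj₂ (inj₂ (inj₁ (cong suc i≡k' , j≡0)))
  to (inj₂ e) with next-inv e
  ... | inj₁ sj           = inj₂ (inj₁ sj)
  ... | inj₂ (j≡k' , i≡0) = inj₂ (inj₂ (inj₂ (cong suc j≡k' , i≡0)))
  wrap : ∀ {a b} → suc a ≡ suc k' → b ≡ 0 → next k' a ≡ b
  wrap refl refl = next-last k'
  from : CycAdj (suc k') i j → CycNbr k' (toℕ i) (toℕ j)
  from (inj₁ si)                      = consecutive⇒cycNbr (toℕ<n i) (toℕ<n j) (inj₁ si)
  from (inj₂ (inj₁ sj))               = consecutive⇒cycNbr (toℕ<n i) (toℕ<n j) (inj₂ sj)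
  from (inj₂ (inj₂ (inj₁ (e , z))))   = inj₁ (wrap e z)
  from (inj₂ (inj₂ (inj₂ (e , z))))   = inj₂ (wrap e z)

cycNbr-next : ∀ {k' i j} → CycNbr k' (next k' i) (next k' j) ⇔ CycNbr k' i j
cycNbr-next {k'} = mk⇔ (Sum.map (next-injective _ _) (next-injective _ _))
                       (Sum.map (cong (next k')) (cong (next k')))

sumTo-next : ∀ F k' → sumTo (λ j → F (next k' j)) (suc k') ≡ sumTo F (suc k')
sumTo-next F k' = begin
    sumTo (λ j → F (next k' j)) (suc k')
  ≡⟨ sumTo-snoc _ k' ⟩
    sumTo (λ j → F (next k' j)) k' + F (next k' k')
  ≡⟨ cong₂ _+_ (sumTo-cong _ _ k' (λ j j<k' → cong F (next-below j<k'))) (cong F (next-last k')) ⟩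
    sumTo (λ j → F (suc j)) k' + F 0
  ≡⟨ +-comm _ (F 0) ⟩
    sumTo F (suc k')
  ∎
  where open ≡-Reasoning

shift : ℕ → ℕ → ℕ → ℕ
shift k' zero    j = j
shift k' (suc i) j = next k' (shift k' i j)

shift-bounded : ∀ {k' j} i → j < suc k' → shift k' i j < suc k'
shift-bounded zero    j< = j<
shift-bounded (suc i) j< = next-bounded _ (shift-bounded i j<)

shift-start : ∀ {k'} i → i < suc k' → shift k' i 0 ≡ i
shift-start zero    _          = refl
shift-start (suc i) (s≤s i<k') =
  trans (cong (next _) (shift-start i (m<n⇒m<1+n i<k'))) (next-below i<k')

sumTo-shift : ∀ {k'} i F → sumTo (λ j → F (shift k' i j)) (suc k') ≡ sumTo F (suc k')
sumTo-shift zero    F = refl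
sumTo-shift {k'} (suc i) F = trans (sumTo-shift i (λ j → F (next k' j))) (sumTo-next F k')

-- A stretch b, …, b + len of 1..k' (hence without wrap-around) has the same
-- neighbourhoods as positions 1, …, len + 1 of the cycle 0, …, len + 1.
stretchNbr : ∀ {k' b len t t'} → 1 ≤ b → b + len ≤ k' → t < suc len → t' < suc len →
             CycNbr k' (b + t) (b + t') ⇔ CycNbr (suc len) (suc t) (suc t')
stretchNbr {k'} {b} {len} {t} {t'} b≥1 end≤ t< t'< = mk⇔ to from
  where
  inside : ∀ {x} → x < suc len → b + x < suc k'
  inside x< = s≤s (≤-trans (+-monoʳ-≤ b (≤-pred x<)) end≤)
  positive : ∀ x → 1 ≤ b + x
  positive x = ≤-trans b≥1 (m≤m+n b x)
  shifted : ∀ x y → suc (b + x) ≡ b + y ⇔ suc x ≡ y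
  shifted x y = mk⇔ (λ e → +-cancelˡ-≡ b (suc x) y (trans (+-suc b x) e))
                    (λ e → trans (sym (+-suc b x)) (cong (b +_) e))
  to : CycNbr k' (b + t) (b + t') → CycNbr (suc len) (suc t) (suc t')
  to nbr = consecutive⇒cycNbr (s≤s t<) (s≤s t'<)
    (Sum.map (cong suc ∘ Equivalence.to (shifted t t')) (cong suc ∘ Equivalence.to (shifted t' t))
      (cycNbr⇒consecutive (positive t) (positive t') nbr))
  from : CycNbr (suc len) (suc t) (suc t') → CycNbr k' (b + t) (b + t')
  from nbr = consecutive⇒cycNbr (inside t<) (inside t'<)
    (Sum.map (Equivalence.from (shifted t t') ∘ suc-injective) (Equivalence.from (shifted t' t) ∘ suc-injective)
      (cycNbr⇒consecutive (s≤s z≤n) (s≤s z≤n) nbr))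

_◃_ : {A : Set} → A → (ℕ → A) → ℕ → A
(v ◃ f) zero    = v
(v ◃ f) (suc t) = f t

toℕ-mod : ∀ {k' j} → j < suc k' → toℕ (j mod suc k') ≡ j
toℕ-mod {k'} {j} j< = trans (toℕ-fromℕ< _) (m<n⇒m%n≡m j<)

module _ {n : ℕ} (G : Graph n) where

  edge? : ∀ x y → Dec (Edge G x y)
  edge? x y = adj G x y Bool.≟ true

  edge-sym : ∀ {x y} → Edge G x y → Edge G y x
  edge-sym {x} {y} e = trans (adj-sym G y x) e

  edge-comm : ∀ {x y} → Edge G x y ⇔ Edge G y x
  edge-comm = mk⇔ edge-sym edge-sym

  edge-irrefl : ∀ {x} → ¬ Edge G x x
  edge-irrefl {x} e = contradiction (trans (sym e) (adj-irref G x)) λ ()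

  walk? : ∀ k x y → Dec (Walk G x y k)
  walk? zero x y with x Fin.≟ y
  ... | yes refl = yes nil
  ... | no x≢y   = no λ { nil → x≢y refl }
  walk? (suc k) x y with any? (λ u → edge? x u ×-dec walk? k u y)
  ... | yes (u , e , walk) = yes (cons e walk)
  ... | no none            = no λ { (cons e walk) → none (_ , e , walk) }

  center∈disk : ∀ c r → InDisk G c r c
  center∈disk c r = 0 , z≤n , nil

  edge⇒unitDisk : ∀ {u c} → Edge G u c → InDisk G c 1 u
  edge⇒unitDisk e = 1 , ≤-refl , cons e nil

  unitDisk⇒≡⊎edge : ∀ {u c} → InDisk G c 1 u → u ≡ c ⊎ Edge G u c
  unitDisk⇒≡⊎edge (zero , _ , nil)              = inj₁ refl
  unitDisk⇒≡⊎edge (suc zero , _ , cons e nil)   = inj₂ e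
  unitDisk⇒≡⊎edge (suc (suc _) , s≤s () , _)

  radius0 : ∀ {w x} → InDisk G w 0 x → x ≡ w
  radius0 (zero , _ , nil) = refl

  stepToward : ∀ {w x r} → InDisk G w (suc r) x → Σ (Fin n) λ u → InDisk G x 1 u × InDisk G w r u
  stepToward {x = x} (zero , _ , nil)         = x , center∈disk x 1 , center∈disk x _
  stepToward (suc k , s≤s k≤r , cons e walk) = _ , edge⇒unitDisk (edge-sym e) , k , k≤r , walk

  Meet : Fin n → ℕ → Fin n → ℕ → Set
  Meet c r c' r' = Σ (Fin n) λ u → InDisk G c r u × InDisk G c' r' u

  helly4 : Helly G → ∀ {a b c d ra rb rc rd} →
           Meet a ra b rb → Meet a ra c rc → Meet a ra d rd →
           Meet b rb c rc → Meet b rb d rd → Meet c rc d rd →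
           Σ (Fin n) λ u → InDisk G a ra u × InDisk G b rb u × InDisk G c rc u × InDisk G d rd u
  helly4 helly {a} {b} {c} {d} {ra} {rb} {rc} {rd} ab ac ad bc bd cd =
    let (u , inAll) = helly 4 center radius meet
    in  u , inAll 0F , inAll 1F , inAll 2F , inAll 3F
    where
    center : Fin 4 → Fin n
    center 0F = a
    center 1F = b
    center 2F = c
    center 3F = d
    radius : Fin 4 → ℕ
    radius 0F = ra
    radius 1F = rb
    radius 2F = rc
    radius 3F = rd
    meet-self : ∀ i → Meet (center i) (radius i) (center i) (radius i)
    meet-self i = center i , center∈disk _ _ , center∈disk _ _
    meet-swap : ∀ {x r y s} → Meet x r y s → Meet y s x r
    meet-swap (u , p , q) = u , q , p
    meet : ∀ i j → Meet (center i) (radius i) (center j) (radius j)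
    meet 0F 0F = meet-self 0F
    meet 1F 1F = meet-self 1F
    meet 2F 2F = meet-self 2F
    meet 3F 3F = meet-self 3F
    meet 0F 1F = ab
    meet 0F 2F = ac
    meet 0F 3F = ad
    meet 1F 2F = bc
    meet 1F 3F = bd
    meet 2F 3F = cd
    meet 1F 0F = meet-swap ab
    meet 2F 0F = meet-swap ac
    meet 3F 0F = meet-swap ad
    meet 2F 1F = meet-swap bc
    meet 3F 1F = meet-swap bd
    meet 3F 2F = meet-swap cd

  commonNearToward : Helly G → ∀ {x y z w r} → Edge G x y → Edge G x z →
                     InDisk G w (suc r) x → InDisk G w (suc r) y → InDisk G w (suc r) z →
                     Σ (Fin n) λ v → InDisk G x 1 v × InDisk G y 1 v × InDisk G z 1 v × InDisk G w r v
  commonNearToward helly {x} xy xz wx wy wz =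
    helly4 helly (x , center∈disk x 1 , edge⇒unitDisk xy) (x , center∈disk x 1 , edge⇒unitDisk xz)
                 (stepToward wx) (x , edge⇒unitDisk xy , edge⇒unitDisk xz)
                 (stepToward wy) (stepToward wz)

  record CycleOn (k' : ℕ) (f : ℕ → Fin n) : Set where
    field
      injective : ∀ i j → i < suc k' → j < suc k' → f i ≡ f j → i ≡ j
      adjacent  : ∀ i j → i < suc k' → j < suc k' → Edge G (f i) (f j) ⇔ CycNbr k' i j
  open CycleOn

  cycleOn⇒induced : ∀ {k' g} → CycleOn k' g → InducedCycle G (suc k') (λ x → g (toℕ x))
  cycleOn⇒induced cyc =
    (λ e → toℕ-injective (injective cyc _ _ (toℕ<n _) (toℕ<n _) e)) ,
    λ x y → ⇔.trans (adjacent cyc _ _ (toℕ<n x) (toℕ<n y)) (cycNbr⇔cycAdj x y)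

  induced⇒cycleOn : ∀ {k' c} → InducedCycle G (suc k') c → CycleOn k' (λ j → c (j mod suc k'))
  induced⇒cycleOn {k'} (inj , adjacency) = record
    { injective = λ i j i< j< e → trans (sym (toℕ-mod i<)) (trans (cong toℕ (inj e)) (toℕ-mod j<))
    ; adjacent  = λ i j i< j< →
        ⇔.trans (adjacency _ _)
          (⇔.trans (⇔.sym (cycNbr⇔cycAdj _ _))
                   (mk⇔ (subst₂ (CycNbr k') (toℕ-mod i<) (toℕ-mod j<))
                        (subst₂ (CycNbr k') (sym (toℕ-mod i<)) (sym (toℕ-mod j<)))))
    }

  rotate : ∀ {k' f} → CycleOn k' f → CycleOn k' (λ j → f (next k' j))
  rotate cyc = record
    { injective = λ i j i< j< e →
        next-injective i j (injective cyc _ _ (next-bounded i i<) (next-bounded j j<) e)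
    ; adjacent  = λ i j i< j< → ⇔.trans (adjacent cyc _ _ (next-bounded i i<) (next-bounded j j<)) cycNbr-next
    }

  rotateBy : ∀ {k' f} i → CycleOn k' f → CycleOn k' (λ j → f (shift k' i j))
  rotateBy zero    cyc = cyc
  rotateBy (suc i) cyc = rotateBy i (rotate cyc)

  nearOnCycle : ∀ {k' g i j} → CycleOn k' g → i < suc k' → j < suc k' →
                InDisk G (g i) 1 (g j) → j ≡ i ⊎ CycNbr k' j i
  nearOnCycle cyc i< j< d =
    Sum.map (injective cyc _ _ j< i<) (Equivalence.to (adjacent cyc _ _ j< i<)) (unitDisk⇒≡⊎edge d)

  onlyMiddleNear : ∀ {k' g j} → CycleOn k' g → 3 ≤ k' → j < suc k' →
                   InDisk G (g k') 1 (g j) → InDisk G (g 0) 1 (g j) → InDisk G (g 1) 1 (g j) → j ≡ 0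
  onlyMiddleNear {k'} {g} {j} cyc k'≥3 j< nearLast near0 near1 = [ id , neighbourOf0 ]′ (nearOnCycle cyc (s≤s z≤n) j< near0)
    where
    1< : 1 < suc k'
    1< = m<n⇒m<1+n (1<last k'≥3)
    -- the neighbours k' and 1 of g 0 are each too far from the other one
    neighbourOf0 : CycNbr k' j 0 → j ≡ 0
    neighbourOf0 (inj₁ next-j≡0) with next-inv next-j≡0
    ... | inj₁ ()
    ... | inj₂ (refl , _) =
      ⊥-elim (1-far-from-last k'≥3 (Sum.map sym (Equivalence.to cycNbr-comm) (nearOnCycle cyc 1< ≤-refl near1)))
    neighbourOf0 (inj₂ next-0≡j) with trans (sym (next-below (<-trans (s≤s z≤n) (1<last k'≥3)))) next-0≡j
    ... | refl = ⊥-elim (1-far-from-last k'≥3 (nearOnCycle cyc ≤-refl 1< nearLast))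

  wheel : ∀ {k' g v} → CycleOn k' g → (∀ j → j < suc k' → v ≢ g j) →
          (∀ j → j < suc k' → Edge G v (g j)) → HasInducedWheel G (suc k')
  wheel {v = v} cyc off adjacentToAll =
    v , _ , cycleOn⇒induced cyc , (λ x → off (toℕ x) (toℕ<n x)) , (λ x → adjacentToAll (toℕ x) (toℕ<n x))

  shortcut : ∀ {k' g v b len} → CycleOn k' g → (∀ j → j < suc k' → v ≢ g j) →
             1 ≤ b → b + len ≤ k' → Edge G v (g b) → Edge G v (g (b + len)) →
             (∀ t → 0 < t → t < len → ¬ Edge G v (g (b + t))) →
             CycleOn (suc len) (v ◃ λ t → g (b + t))
  shortcut {k'} {g} {v} {b} {len} cyc off b≥1 end≤ atStart atEnd between = record
    { injective = distinct
    ; adjacent  = adjacency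
    }
    where
    inside : ∀ {t} → t < suc len → b + t < suc k'
    inside t< = s≤s (≤-trans (+-monoʳ-≤ b (≤-pred t<)) end≤)

    hubEdge : ∀ t → t < suc len → Edge G v (g (b + t)) ⇔ (t ≡ 0 ⊎ t ≡ len)
    hubEdge t t< = mk⇔ (to t t<) [ (λ { refl → subst (λ x → Edge G v (g x)) (sym (+-identityʳ b)) atStart })
                                 , (λ { refl → atEnd }) ]′
      where
      to : ∀ t → t < suc len → Edge G v (g (b + t)) → t ≡ 0 ⊎ t ≡ len
      to zero    _  _ = inj₁ refl
      to (suc t) t< e with suc t ≟ len
      ... | yes t+1≡len = inj₂ t+1≡len
      ... | no  t+1≢len = ⊥-elim (between (suc t) (s≤s z≤n) (≤∧≢⇒< (≤-pred t<) t+1≢len) e)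

    distinct : ∀ i j → i < suc (suc len) → j < suc (suc len) →
               (v ◃ λ t → g (b + t)) i ≡ (v ◃ λ t → g (b + t)) j → i ≡ j
    distinct zero    zero    _  _  _ = refl
    distinct zero    (suc t) _  j< e = ⊥-elim (off _ (inside (≤-pred j<)) e)
    distinct (suc t) zero    i< _  e = ⊥-elim (off _ (inside (≤-pred i<)) (sym e))
    distinct (suc t) (suc t') i< j< e =
      cong suc (+-cancelˡ-≡ b t t' (injective cyc _ _ (inside (≤-pred i<)) (inside (≤-pred j<)) e))

    adjacency : ∀ i j → i < suc (suc len) → j < suc (suc len) →
                Edge G ((v ◃ λ t → g (b + t)) i) ((v ◃ λ t → g (b + t)) j) ⇔ CycNbr (suc len) i j
    adjacency zero    zero    _  _  = mk⇔ (⊥-elim ∘ edge-irrefl) (λ nbr → ⊥-elim (cycNbr-irrefl {suc len} {0} (s≤s z≤n) nbr))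
    adjacency zero    (suc t) _  j< = ⇔.trans (hubEdge t (≤-pred j<)) (⇔.sym cycNbr-of-0)
    adjacency (suc t) zero    i< j< = ⇔.trans edge-comm (⇔.trans (adjacency zero (suc t) j< i<) cycNbr-comm)
    adjacency (suc t) (suc t') i< j< =
      ⇔.trans (adjacent cyc _ _ (inside (≤-pred i<)) (inside (≤-pred j<)))
              (stretchNbr b≥1 end≤ (≤-pred i<) (≤-pred j<))

  record LongCycle : Set where
    field
      last    : ℕ
      vertex  : ℕ → Fin n
      last≥3  : 3 ≤ last
      induced : CycleOn last vertex

module Distances {n : ℕ} (G : Graph n) (conn : Connected G) (w : Fin n) where

  private
    shortest : ∀ x → Σ ℕ λ k → Walk G x w k × (∀ j → j < k → ¬ Walk G x w j)
    shortest x = leastWitness (λ k → walk? G k x w) (proj₁ (conn x w)) (proj₂ (conn x w))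

  dist : Fin n → ℕ
  dist x = proj₁ (shortest x)

  dist≤⇒inDisk : ∀ {x r} → dist x ≤ r → InDisk G w r x
  dist≤⇒inDisk {x} d≤r = dist x , d≤r , proj₁ (proj₂ (shortest x))

  inDisk⇒dist≤ : ∀ {x r} → InDisk G w r x → dist x ≤ r
  inDisk⇒dist≤ {x} (k , k≤r , walk) = ≤-trans (≮⇒≥ λ k<d → proj₂ (proj₂ (shortest x)) k k<d walk) k≤r

  potentialOf : ℕ → (ℕ → Fin n) → ℕ
  potentialOf k' f = sumTo (λ j → dist (f j)) (suc k')

  potential : LongCycle G → ℕ
  potential C = potentialOf (LongCycle.last C) (LongCycle.vertex C)

  shortcut-potential : ∀ {k' g v b len} → 1 ≤ b → b + len ≤ k' → dist v < dist (g 0) →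
                       potentialOf (suc len) (v ◃ λ t → g (b + t)) < potentialOf k' g
  shortcut-potential {k'} {g} {v} {suc a} {len} (s≤s z≤n) end≤ closer =
    +-mono-<-≤ closer (sumTo-window (λ t → dist (g (suc t))) a (suc len) k'
                                    (subst (_≤ k') (sym (+-suc a len)) end≤))

  FarthestFirst : LongCycle G → Set
  FarthestFirst C = ∀ j → j < suc last → dist (vertex j) ≤ dist (vertex 0)
    where open LongCycle C

  farthestFirst : (C : LongCycle G) → Σ (LongCycle G) λ C' → potential C' ≡ potential C × FarthestFirst C'
  farthestFirst C = rotated (argmax (λ j → dist (vertex j)) last)
    where
    open LongCycle C
    rotated : (Σ ℕ λ i → i < suc last × (∀ j → j < suc last → dist (vertex j) ≤ dist (vertex i))) →
              Σ (LongCycle G) λ C' → potential C' ≡ potential C × FarthestFirst C'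
    rotated (i , i< , max) =
      record { last = last ; vertex = λ j → vertex (shift last i j) ; last≥3 = last≥3
             ; induced = rotateBy G i induced } ,
      sumTo-shift i (λ j → dist (vertex j)) ,
      λ j j< → subst (dist (vertex (shift last i j)) ≤_) (cong (dist ∘ vertex) (sym (shift-start i i<)))
                     (max _ (shift-bounded i j<))

  record Hub (C : LongCycle G) : Set where
    open LongCycle C
    field
      hub      : Fin n
      closer   : dist hub < dist (vertex 0)
      off      : ∀ j → j < suc last → hub ≢ vertex j
      adj₀     : Edge G hub (vertex 0)
      adj₁     : Edge G hub (vertex 1)
      adjLast  : Edge G hub (vertex last)

  findHub : Helly G → (C : LongCycle G) → FarthestFirst C → Hub C
  findHub helly C far = record
    { hub = v ; closer = v-closer ; off = v-off
    ; adj₀ = adjacentIfNear 0 0< v∈D₀ ; adj₁ = adjacentIfNear 1 1< v∈D₁ ; adjLast = adjacentIfNear k' ≤-refl v∈Dₖ }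
    where
    open LongCycle C renaming (last to k'; vertex to g; last≥3 to k'≥3; induced to cyc)
    open CycleOn

    0< : 0 < suc k'
    0< = s≤s z≤n
    1< : 1 < suc k'
    1< = m<n⇒m<1+n (1<last k'≥3)

    -- g 0 ≠ w: otherwise g 1, being no farther, would be w as well.
    d₀≢0 : dist (g 0) ≢ 0
    d₀≢0 d₀≡0 = contradiction
      (injective cyc 0 1 0< 1< (trans (radius0 G (dist≤⇒inDisk (≤-reflexive d₀≡0)))
                                      (sym (radius0 G (dist≤⇒inDisk (subst (dist (g 1) ≤_) d₀≡0 (far 1 1<)))))))
      λ ()

    r : ℕ
    r = pred (dist (g 0))
    d₀≡r+1 : suc r ≡ dist (g 0)
    d₀≡r+1 = suc-pred (dist (g 0)) {{≢-nonZero d₀≢0}}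

    within : ∀ j → j < suc k' → InDisk G w (suc r) (g j)
    within j j< = dist≤⇒inDisk (subst (dist (g j) ≤_) (sym d₀≡r+1) (far j j<))

    near : Σ (Fin n) λ v → InDisk G (g 0) 1 v × InDisk G (g k') 1 v × InDisk G (g 1) 1 v × InDisk G w r v
    near = commonNearToward G helly
             (Equivalence.from (adjacent cyc 0 k' 0< ≤-refl) (inj₂ (next-last k')))
             (Equivalence.from (adjacent cyc 0 1 0< 1<) (inj₁ (next-below (<-trans (s≤s z≤n) (1<last k'≥3)))))
             (within 0 0<) (within k' ≤-refl) (within 1 1<)
    v : Fin n
    v = proj₁ near
    v∈D₀ : InDisk G (g 0) 1 v
    v∈D₀ = proj₁ (proj₂ near)
    v∈Dₖ : InDisk G (g k') 1 v
    v∈Dₖ = proj₁ (proj₂ (proj₂ near))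
    v∈D₁ : InDisk G (g 1) 1 v
    v∈D₁ = proj₁ (proj₂ (proj₂ (proj₂ near)))
    v∈Dw : InDisk G w r v
    v∈Dw = proj₂ (proj₂ (proj₂ (proj₂ near)))

    v-closer : dist v < dist (g 0)
    v-closer = subst (dist v <_) d₀≡r+1 (s≤s (inDisk⇒dist≤ v∈Dw))

    v-off : ∀ j → j < suc k' → v ≢ g j
    v-off j j< v≡gj = <-irrefl (trans (cong dist v≡gj) (cong (dist ∘ g) j≡0)) v-closer
      where
      j≡0 : j ≡ 0
      j≡0 = onlyMiddleNear G cyc k'≥3 j< (subst (InDisk G (g k') 1) v≡gj v∈Dₖ)
              (subst (InDisk G (g 0) 1) v≡gj v∈D₀) (subst (InDisk G (g 1) 1) v≡gj v∈D₁)

    adjacentIfNear : ∀ j → j < suc k' → InDisk G (g j) 1 v → Edge G v (g j)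
    adjacentIfNear j j< d = [ (λ v≡gj → ⊥-elim (v-off j j< v≡gj)) , id ]′ (unitDisk⇒≡⊎edge G d)

  shorten : (∀ k → 4 ≤ k → ¬ HasInducedWheel G k) → (C : LongCycle G) → Hub C →
            Σ (LongCycle G) λ C' → potential C' < potential C
  shorten noWheel C h =
    [ (λ all → ⊥-elim (noWheel (suc k') (s≤s k'≥3) (wheel G cyc off (adjacentToAll all))))
    , shorter ]′
    (allOrGap (λ j → edge? G hub (g j)) k' adj₁ adjLast)
    where
    open LongCycle C renaming (last to k'; vertex to g; last≥3 to k'≥3; induced to cyc)
    open Hub h

    adjacentToAll : (∀ j → 1 ≤ j → j ≤ k' → Edge G hub (g j)) → ∀ j → j < suc k' → Edge G hub (g j)
    adjacentToAll all zero    _           = adj₀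
    adjacentToAll all (suc j) (s≤s j<k') = all (suc j) (s≤s z≤n) j<k'

    shorter : Gap (λ j → Edge G hub (g j)) k' → Σ (LongCycle G) λ C' → potential C' < potential C
    shorter gap =
      record { last = suc len ; vertex = hub ◃ (λ t → g (start + t)) ; last≥3 = s≤s len≥2
             ; induced = shortcut G cyc off start≥1 end≤m atStart atEnd between } ,
      shortcut-potential {g = g} {v = hub} start≥1 end≤m closer
      where open Gap gap

  noLongCycle : Helly G → (∀ k → 4 ≤ k → ¬ HasInducedWheel G k) → LongCycle G → ⊥
  noLongCycle helly noWheel C = <-rec (λ m → ∀ C → potential C ≡ m → ⊥) step (potential C) C refl
    where
    step : ∀ m → (∀ {m'} → m' < m → ∀ C → potential C ≡ m' → ⊥) → ∀ C → potential C ≡ m → ⊥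
    step _ smaller C refl =
      let (C' , same , far) = farthestFirst C
          (C'' , lower)     = shorten noWheel C' (findHub helly C' far)
      in  smaller (subst (potential C'' <_) same lower) C'' refl

lemma7 : ∀ (n : ℕ) (G : Graph n) → Connected G → Helly G →
         (∀ k → 4 ≤ k → ¬ HasInducedWheel G k) →
         Chordal G
lemma7 n G conn helly noWheel (suc k') (s≤s k'≥3) (c , cycle) =
  noLongCycle helly noWheel (record
    { last = k' ; vertex = λ j → c (j mod suc k') ; last≥3 = k'≥3 ; induced = induced⇒cycleOn G cycle })
  where open Distances G conn (c Fin.zero)
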